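{- Let $M$ be a connected binary matroid having a totally odd cycle basis. Then any two odd cycles of $M$ have an odd number of common elements.
   Context: Matroids are loopless. A matroid is binary if representable over $\mathbb{F}_2$; connected if it has at least two elements and any two distinct elements lie in a common circuit. A cycle is a union of disjoint circuits, odd if it has an odd number of elements. For binary $M$ with ground set $S$, the incidence vectors of cycles form a subspace $\mathcal{C}(M)\subseteq\mathbb{F}_2^S$; a cycle basis is a set of cycles whose incidence vectors form a basis of $\mathcal{C}(M)$. A cycle basis is odd if all its elements are odd, and an odd cycle basis is totally odd if any two of its elements share an odd number of elements. -}

module Defs where

open import Data.Nat using (ℕ; zero; suc; _+_; _*_; _≤_)
open import Data.Bool using (Bool; true; false; _xor_)
open import Data.Fin using (Fin)
open import Data.Fin.Subset using (Subset; _∈_; _⊂_; _∩_; ∣_∣; Nonempty; Empty; ⁅_⁆; ⊥)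
open import Data.Vec using (Vec; []; _∷_; zipWith; replicate; tabulate; lookup)
open import Data.List using (List; []; _∷_; foldr)
open import Data.List.Relation.Unary.All using (All)
open import Data.List.Relation.Unary.AllPairs using (AllPairs)
open import Data.Product using (Σ; ∃; _×_; _,_)
open import Relation.Binary.PropositionalEquality using (_≡_; _≢_)
open import Relation.Nullary using (¬_)

Odd : ℕ → Set
Odd k = Σ ℕ λ j → k ≡ suc (2 * j)

_⊕_ : ∀ {n} → Subset n → Subset n → Subset n
_⊕_ = zipWith _xor_

infixl 6 _⊕_

-- A binary matroid on the ground set S = Fin n, given by an F₂-representation:
-- an m × n matrix over F₂ = Bool, stored by columns (column e is the vector of element e).
record BinaryMatroid (n : ℕ) : Set where
  field
    rows : ℕ
    col  : Fin n → Vec Bool rows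

module _ {n : ℕ} (M : BinaryMatroid n) where
  open BinaryMatroid M

  colSum : Subset n → Vec Bool rows
  colSum X = go X col
    where
      go : ∀ {k} → Subset k → (Fin k → Vec Bool rows) → Vec Bool rows
      go []           c = replicate rows false
      go (true  ∷ xs) c = zipWith _xor_ (c Fin.zero) (go xs (λ i → c (Fin.suc i)))
      go (false ∷ xs) c = go xs (λ i → c (Fin.suc i))

  Dependent : Subset n → Set
  Dependent X = Σ (Subset n) λ Y → (Y Data.Fin.Subset.⊆ X) × Nonempty Y × colSum Y ≡ replicate rows false

  Circuit : Subset n → Set
  Circuit C = Dependent C × (∀ D → D ⊂ C → ¬ Dependent D)

  Loopless : Set
  Loopless = ∀ e → ¬ Circuit ⁅ e ⁆

  Connected : Set
  Connected = (2 ≤ n) × (∀ e f → e ≢ f → Σ (Subset n) λ C → Circuit C × e ∈ C × f ∈ C)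

  ⋃ : List (Subset n) → Subset n
  ⋃ = foldr Data.Fin.Subset._∪_ ⊥

  Disjoint : Subset n → Subset n → Set
  Disjoint X Y = Empty (X ∩ Y)

  Cycle : Subset n → Set
  Cycle X = Σ (List (Subset n)) λ Cs → All Circuit Cs × AllPairs Disjoint Cs × ⋃ Cs ≡ X

  OddSet : Subset n → Set
  OddSet X = Odd ∣ X ∣

  lincomb : ∀ {k} → Vec (Subset n) k → Vec Bool k → Subset n
  lincomb []       []            = ⊥
  lincomb (B ∷ Bs) (true  ∷ s)  = B ⊕ lincomb Bs s
  lincomb (B ∷ Bs) (false ∷ s)  = lincomb Bs s

  CycleBasis : ∀ {k} → Vec (Subset n) k → Set
  CycleBasis {k} B =
    (∀ i → Cycle (lookup B i))
    × (∀ s → lincomb B s ≡ ⊥ → s ≡ replicate k false)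
    × (∀ X → Cycle X → Σ (Vec Bool k) λ s → lincomb B s ≡ X)

  OddCycleBasis : ∀ {k} → Vec (Subset n) k → Set
  OddCycleBasis B = CycleBasis B × (∀ i → OddSet (lookup B i))

  TotallyOddCycleBasis : ∀ {k} → Vec (Subset n) k → Set
  TotallyOddCycleBasis B =
    OddCycleBasis B × (∀ i j → i ≢ j → OddSet (lookup B i ∩ lookup B j))

-- Over F₂, ⟨u , w⟩ = |u ∩ w| mod 2 is a symmetric bilinear form with ⟨u , u⟩ = |u| mod 2.
-- Write X = Σ s B and Y = Σ t B in the totally odd cycle basis B. Since every Bᵢ is
-- odd, |X| ≡ |s| and |Y| ≡ |t| (mod 2), so s and t have odd support. Since moreover
-- ⟨Bᵢ , Bⱼ⟩ = 1 for all i and j, bilinearity gives ⟨X , Y⟩ = |s| |t| = 1.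
module Submission where

open import Defs
open import Data.Nat using (ℕ; zero; suc; _+_; _*_)
open import Data.Nat.Properties using (+-suc)
open import Data.Bool using (Bool; true; false; _xor_; _∧_; not)
open import Data.Bool.Properties
  using (not-involutive; ∧-zeroʳ; ∧-identityʳ; ∧-distribˡ-xor; ∧-distribʳ-xor; xor-∧-commutativeRing)
open import Data.Vec using (Vec; []; _∷_; lookup)
open import Data.Fin using (_≟_)
import Data.Fin as Fin
open import Data.Fin.Subset using (Subset; _∩_; ∣_∣; ⊥)
open import Data.Fin.Subset.Properties using (∩-comm; ∩-idem; ∩-zeroˡ)
open import Data.Product using (Σ; _,_)
open import Relation.Binary.PropositionalEquality
open import Relation.Nullary using (yes; no)
open import Function using (_∘_)
open import Algebra.Bundles using (CommutativeRing)
open import Algebra.Properties.CommutativeSemigroup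
  (CommutativeRing.+-commutativeSemigroup xor-∧-commutativeRing) using (interchange)

odd? : ℕ → Bool
odd? zero    = false
odd? (suc k) = not (odd? k)

odd?-suc-suc : ∀ k → odd? (suc (suc k)) ≡ odd? k
odd?-suc-suc k = not-involutive (odd? k)

odd?-double : ∀ j → odd? (2 * j) ≡ false
odd?-double zero    = refl
odd?-double (suc j) rewrite +-suc j (j + 0) = trans (odd?-suc-suc (2 * j)) (odd?-double j)

Odd⇒odd? : ∀ {k} → Odd k → odd? k ≡ true
Odd⇒odd? (j , refl) = cong not (odd?-double j)

odd?⇒Odd : ∀ k → odd? k ≡ true → Odd k
odd?⇒Odd zero          ()
odd?⇒Odd (suc zero)    _ = 0 , refl
odd?⇒Odd (suc (suc k)) p with odd?⇒Odd k (trans (sym (odd?-suc-suc k)) p)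
... | j , refl = suc j , cong (λ m → suc (suc m)) (sym (+-suc j (j + 0)))

parity : ∀ {n} → Subset n → Bool
parity []      = false
parity (b ∷ v) = b xor parity v

odd?-∣∣ : ∀ {n} (X : Subset n) → odd? ∣ X ∣ ≡ parity X
odd?-∣∣ []          = refl
odd?-∣∣ (true ∷ X)  = cong not (odd?-∣∣ X)
odd?-∣∣ (false ∷ X) = odd?-∣∣ X

Odd∣∣⇒parity : ∀ {n} (X : Subset n) → Odd ∣ X ∣ → parity X ≡ true
Odd∣∣⇒parity X o = trans (sym (odd?-∣∣ X)) (Odd⇒odd? o)

parity⇒Odd∣∣ : ∀ {n} (X : Subset n) → parity X ≡ true → Odd ∣ X ∣
parity⇒Odd∣∣ X p = odd?⇒Odd ∣ X ∣ (trans (odd?-∣∣ X) p)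

parity-⊥ : ∀ n → parity (⊥ {n}) ≡ false
parity-⊥ zero    = refl
parity-⊥ (suc n) = parity-⊥ n

parity-⊕ : ∀ {n} (u v : Subset n) → parity (u ⊕ v) ≡ parity u xor parity v
parity-⊕ []      []      = refl
parity-⊕ (a ∷ u) (b ∷ v) =
  trans (cong ((a xor b) xor_) (parity-⊕ u v)) (interchange a b (parity u) (parity v))

∩-distribʳ-⊕ : ∀ {n} (u v w : Subset n) → (u ⊕ v) ∩ w ≡ (u ∩ w) ⊕ (v ∩ w)
∩-distribʳ-⊕ []      []      []      = refl
∩-distribʳ-⊕ (a ∷ u) (b ∷ v) (c ∷ w) = cong₂ _∷_ (∧-distribʳ-xor c a b) (∩-distribʳ-⊕ u v w)

⟨_,_⟩ : ∀ {n} → Subset n → Subset n → Bool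
⟨ u , w ⟩ = parity (u ∩ w)

⟨⟩-comm : ∀ {n} (u w : Subset n) → ⟨ u , w ⟩ ≡ ⟨ w , u ⟩
⟨⟩-comm u w = cong parity (∩-comm u w)

⟨⟩-self : ∀ {n} (u : Subset n) → ⟨ u , u ⟩ ≡ parity u
⟨⟩-self u = cong parity (∩-idem u)

⟨⊥,⟩ : ∀ {n} (w : Subset n) → ⟨ ⊥ , w ⟩ ≡ false
⟨⊥,⟩ {n} w = trans (cong parity (∩-zeroˡ w)) (parity-⊥ n)

⟨⊕,⟩ : ∀ {n} (u v w : Subset n) → ⟨ u ⊕ v , w ⟩ ≡ ⟨ u , w ⟩ xor ⟨ v , w ⟩
⟨⊕,⟩ u v w = trans (cong parity (∩-distribʳ-⊕ u v w)) (parity-⊕ (u ∩ w) (v ∩ w))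

record Linear {n} (f : Subset n → Bool) : Set where
  field
    map-⊥ : f ⊥ ≡ false
    map-⊕ : ∀ u v → f (u ⊕ v) ≡ f u xor f v

parity-linear : ∀ {n} → Linear (parity {n})
parity-linear {n} = record { map-⊥ = parity-⊥ n ; map-⊕ = parity-⊕ }

⟨,⟩-linear : ∀ {n} (w : Subset n) → Linear ⟨_, w ⟩
⟨,⟩-linear w = record { map-⊥ = ⟨⊥,⟩ w ; map-⊕ = λ u v → ⟨⊕,⟩ u v w }

module _ {n} (M : BinaryMatroid n) where

  module _ {f : Subset n → Bool} (f-linear : Linear f) where
    open Linear f-linear

    lincomb-constant : ∀ {k} (B : Vec (Subset n) k) {c} → (∀ i → f (lookup B i) ≡ c)
                     → ∀ s → f (lincomb M B s) ≡ c ∧ parity s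
    lincomb-constant []      {c} _    []          = trans map-⊥ (sym (∧-zeroʳ c))
    lincomb-constant (b ∷ B) {c} fB≡c (true ∷ s)  = begin
      f (b ⊕ lincomb M B s)          ≡⟨ map-⊕ b (lincomb M B s) ⟩
      f b xor f (lincomb M B s)      ≡⟨ cong₂ _xor_ (fB≡c Fin.zero) (lincomb-constant B (fB≡c ∘ Fin.suc) s) ⟩
      c xor (c ∧ parity s)           ≡⟨ cong (_xor (c ∧ parity s)) (sym (∧-identityʳ c)) ⟩
      (c ∧ true) xor (c ∧ parity s)  ≡⟨ sym (∧-distribˡ-xor c true (parity s)) ⟩
      c ∧ (true xor parity s)        ∎
      where open ≡-Reasoning
    lincomb-constant (b ∷ B) fB≡c (false ∷ s) = lincomb-constant B (fB≡c ∘ Fin.suc) s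

  parity-lincomb : ∀ {k} (B : Vec (Subset n) k) → (∀ i → parity (lookup B i) ≡ true)
                 → ∀ s → parity (lincomb M B s) ≡ parity s
  parity-lincomb B = lincomb-constant parity-linear B

  ⟨lincomb,lincomb⟩ : ∀ {k} (B : Vec (Subset n) k) → (∀ i j → ⟨ lookup B i , lookup B j ⟩ ≡ true)
                    → ∀ s t → ⟨ lincomb M B s , lincomb M B t ⟩ ≡ parity t ∧ parity s
  ⟨lincomb,lincomb⟩ B gram s t = lincomb-constant (⟨,⟩-linear (lincomb M B t)) B ⟨B,t⟩ s
    where
    ⟨B,t⟩ : ∀ i → ⟨ lookup B i , lincomb M B t ⟩ ≡ parity t
    ⟨B,t⟩ i = trans (⟨⟩-comm (lookup B i) (lincomb M B t))
                    (lincomb-constant (⟨,⟩-linear (lookup B i)) B (λ j → gram j i) t)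

  totallyOdd-gram : ∀ {k} (B : Vec (Subset n) k) → TotallyOddCycleBasis M B
                  → ∀ i j → ⟨ lookup B i , lookup B j ⟩ ≡ true
  totallyOdd-gram B ((_ , odd) , pairwiseOdd) i j with i ≟ j
  ... | yes refl = trans (⟨⟩-self (lookup B i)) (Odd∣∣⇒parity (lookup B i) (odd i))
  ... | no i≢j   = Odd∣∣⇒parity (lookup B i ∩ lookup B j) (pairwiseOdd i j i≢j)

lemma2p11 : ∀ {n} (M : BinaryMatroid n) → Loopless M → Connected M
    → Σ ℕ (λ k → Σ (Vec (Subset n) k) λ B → TotallyOddCycleBasis M B)
    → ∀ X Y → Cycle M X → OddSet M X → Cycle M Y → OddSet M Y
    → OddSet M (X ∩ Y)
lemma2p11 M _ _ (_ , B , totallyOdd@(((_ , _ , spans) , odd) , _)) X Y cycleX oddX cycleY oddY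
  with spans X cycleX | spans Y cycleY
... | s , refl | t , refl = parity⇒Odd∣∣ (X ∩ Y) (begin
  ⟨ lincomb M B s , lincomb M B t ⟩  ≡⟨ ⟨lincomb,lincomb⟩ M B (totallyOdd-gram M B totallyOdd) s t ⟩
  parity t ∧ parity s                ≡⟨ cong₂ _∧_ (odd-coefficients t oddY) (odd-coefficients s oddX) ⟩
  true                               ∎)
  where
  open ≡-Reasoning
  odd-coefficients : ∀ s → OddSet M (lincomb M B s) → parity s ≡ true
  odd-coefficients s oddS = trans (sym (parity-lincomb M B (λ i → Odd∣∣⇒parity (lookup B i) (odd i)) s))
                                  (Odd∣∣⇒parity (lincomb M B s) oddS)
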